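{- An extension $\mathcal{L}$ of $\mathrm{BD}_\infty$ is truth-equational with defining equation $x\vee\neg x\approx x$ if and only if $\mathcal{L}$ validates the rules $\emptyset\vdash x\vee\neg x$ and $x,\ ((x\vee\neg x)\wedge y)\vee z\vdash(x\wedge y)\vee z$.
   Context: Formulas are built from variables using $\wedge,\vee,\neg$. A structure is a pair $\langle\mathbf{A},F\rangle$ with $\mathbf{A}$ an algebra of this signature and $F\subseteq A$; a rule $\Gamma\vdash\varphi$ is valid in it if every homomorphism $v$ from the formula algebra with $v[\Gamma]\subseteq F$ has $v(\varphi)\in F$; a model of a logic is a structure in which all its rules are valid. A logic is a substitution-invariant consequence relation. $\mathrm{BD}_\infty$ is the logic determined by all $\langle\mathbf{A},F\rangle$ with $\mathbf{A}$ a De~Morgan lattice (distributive lattice with $\neg$, $\neg\neg x=x$, De~Morgan laws) and $F$ an upset. The Leibniz congruence $\Omega^{\mathbf{A}}F$ is the largest congruence $\theta$ of $\mathbf{A}$ such that $a\in F$ and $\langle a,b\rangle\in\theta$ imply $b\in F$. $\mathcal{L}$ is truth-equational with defining equation $x\vee\neg x\approx x$ if for every model $\langle\mathbf{A},F\rangle$ of $\mathcal{L}$ and every $a\in A$: $a\in F$ iff $\langle a\vee\neg a,a\rangle\in\Omega^{\mathbf{A}}F$. -}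

module Defs where

open import Level using (Level; Lift; lift; _⊔_) renaming (suc to lsuc; zero to lzero)
open import Data.Nat using (ℕ)
open import Data.Empty using (⊥)
open import Data.Sum using (_⊎_)
open import Data.Product using (Σ; _×_; ∃)
open import Relation.Binary.PropositionalEquality using (_≡_)
open import Relation.Binary.Structures using (IsEquivalence)
open import Algebra.Lattice.Structures using (IsDistributiveLattice)

infixr 6 _∧̂_
infixr 5 _∨̂_
data Fm : Set where
  var   : ℕ → Fm
  _∧̂_   : Fm → Fm → Fm
  _∨̂_   : Fm → Fm → Fm
  ¬̂_    : Fm → Fm

substFm : (ℕ → Fm) → Fm → Fm
substFm σ (var n)  = σ n
substFm σ (φ ∧̂ ψ) = substFm σ φ ∧̂ substFm σ ψ
substFm σ (φ ∨̂ ψ) = substFm σ φ ∨̂ substFm σ ψ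
substFm σ (¬̂ φ)    = ¬̂ substFm σ φ

-- sets of formulas (premises); level 1 so that theories of a logic are sets
FmSet : Set₂
FmSet = Fm → Set₁

_⊆_ : FmSet → FmSet → Set₁
Γ ⊆ Δ = ∀ φ → Γ φ → Δ φ

_[_] : (ℕ → Fm) → FmSet → FmSet
σ [ Γ ] = λ ψ → ∃ λ χ → Γ χ × Lift (lsuc lzero) (ψ ≡ substFm σ χ)

record Algebra : Set₁ where
  field
    Carrier : Set
    _⊓_     : Carrier → Carrier → Carrier
    _⊔ₐ_    : Carrier → Carrier → Carrier
    ∼_      : Carrier → Carrier

⟦_⟧ : ∀ {C : Set} → Fm → (C → C → C) → (C → C → C) → (C → C) → (ℕ → C) → C
⟦ var n ⟧  m j n' v = v n
⟦ φ ∧̂ ψ ⟧ m j n' v = m (⟦ φ ⟧ m j n' v) (⟦ ψ ⟧ m j n' v)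
⟦ φ ∨̂ ψ ⟧ m j n' v = j (⟦ φ ⟧ m j n' v) (⟦ ψ ⟧ m j n' v)
⟦ ¬̂ φ ⟧    m j n' v = n' (⟦ φ ⟧ m j n' v)

eval : (A : Algebra) → (ℕ → Algebra.Carrier A) → Fm → Algebra.Carrier A
eval A v φ = ⟦ φ ⟧ _⊓_ _⊔ₐ_ ∼_ v
  where open Algebra A

ValidIn : (A : Algebra) → (Algebra.Carrier A → Set₁) → FmSet → Fm → Set₁
ValidIn A F Γ φ = ∀ (v : ℕ → Algebra.Carrier A) →
  (∀ ψ → Γ ψ → F (eval A v ψ)) → F (eval A v φ)

record Logic : Set₂ where
  field
    _⊢_        : FmSet → Fm → Set₁
    reflexive  : ∀ {Γ φ} → Γ φ → Γ ⊢ φ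
    monotone   : ∀ {Γ Δ φ} → Γ ⊆ Δ → Γ ⊢ φ → Δ ⊢ φ
    cut        : ∀ {Γ Δ φ} → (∀ ψ → Δ ψ → Γ ⊢ ψ) → Δ ⊢ φ → Γ ⊢ φ
    structural : ∀ {Γ φ} (σ : ℕ → Fm) → Γ ⊢ φ → (σ [ Γ ]) ⊢ substFm σ φ

Model : Logic → (A : Algebra) → (Algebra.Carrier A → Set₁) → Set₂
Model L A F = ∀ Γ φ → Logic._⊢_ L Γ φ → ValidIn A F Γ φ

record DeMorganLattice : Set₁ where
  field
    Carrier : Set
    _⊓_     : Carrier → Carrier → Carrier
    _⊔ₐ_    : Carrier → Carrier → Carrier
    ∼_      : Carrier → Carrier
    isDistributiveLattice : IsDistributiveLattice _≡_ _⊔ₐ_ _⊓_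
    ∼-involutive : ∀ x → ∼ (∼ x) ≡ x
    ∼-⊓ : ∀ x y → ∼ (x ⊓ y) ≡ (∼ x) ⊔ₐ (∼ y)
    ∼-⊔ : ∀ x y → ∼ (x ⊔ₐ y) ≡ (∼ x) ⊓ (∼ y)

  _≤_ : Carrier → Carrier → Set
  x ≤ y = x ⊓ y ≡ x

  toAlgebra : Algebra
  toAlgebra = record { Carrier = Carrier ; _⊓_ = _⊓_ ; _⊔ₐ_ = _⊔ₐ_ ; ∼_ = ∼_ }

IsUpset : (D : DeMorganLattice) → (DeMorganLattice.Carrier D → Set) → Set
IsUpset D F = ∀ {a b} → F a → DeMorganLattice._≤_ D a b → F b

_⊢BD_ : FmSet → Fm → Set₁
Γ ⊢BD φ = ∀ (D : DeMorganLattice) (F : DeMorganLattice.Carrier D → Set) →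
  IsUpset D F →
  ValidIn (DeMorganLattice.toAlgebra D) (λ a → Lift (lsuc lzero) (F a)) Γ φ

ExtendsBD : Logic → Set₂
ExtendsBD L = ∀ Γ φ → Γ ⊢BD φ → Logic._⊢_ L Γ φ

record IsCongruence (A : Algebra) (θ : Algebra.Carrier A → Algebra.Carrier A → Set₁) : Set₁ where
  open Algebra A
  field
    isEquivalence : IsEquivalence θ
    ⊓-cong : ∀ {a b c d} → θ a b → θ c d → θ (a ⊓ c) (b ⊓ d)
    ⊔-cong : ∀ {a b c d} → θ a b → θ c d → θ (a ⊔ₐ c) (b ⊔ₐ d)
    ∼-cong : ∀ {a b} → θ a b → θ (∼ a) (∼ b)

Compatible : (A : Algebra) → (Algebra.Carrier A → Set₁) →
  (Algebra.Carrier A → Algebra.Carrier A → Set₁) → Set₁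
Compatible A F θ = ∀ {a b} → F a → θ a b → F b

-- ⟨a,b⟩ ∈ Ω^A F : ⟨a,b⟩ belongs to the largest compatible congruence,
-- i.e. to some congruence compatible with F (the largest one is their union)
Leibniz : (A : Algebra) → (Algebra.Carrier A → Set₁) →
  Algebra.Carrier A → Algebra.Carrier A → Set₂
Leibniz A F a b = Σ (Algebra.Carrier A → Algebra.Carrier A → Set₁) λ θ →
  IsCongruence A θ × Compatible A F θ × θ a b

TruthEquational : Logic → Set₂
TruthEquational L = ∀ (A : Algebra) (F : Algebra.Carrier A → Set₁) → Model L A F →
  ∀ a → (F a → Leibniz A F (Algebra._⊔ₐ_ A a (Algebra.∼_ A a)) a)
       × (Leibniz A F (Algebra._⊔ₐ_ A a (Algebra.∼_ A a)) a → F a)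

x y z : Fm
x = var 0
y = var 1
z = var 2

∅ : FmSet
∅ = λ _ → Lift (lsuc lzero) ⊥

premises₂ : FmSet
premises₂ ψ = Lift (lsuc lzero) ((ψ ≡ x) ⊎ (ψ ≡ (((x ∨̂ ¬̂ x) ∧̂ y) ∨̂ z)))

ValidatesRules : Logic → Set₁
ValidatesRules L = (∅ ⊢ (x ∨̂ ¬̂ x)) × (premises₂ ⊢ ((x ∧̂ y) ∨̂ z))
  where open Logic L

-- In a model ⟨A, F⟩ of an extension of BD∞ every inequality of De Morgan lattices is a valid
-- single-premise rule. Write s ⊑ᶠ t when every context (– ∧ b) ∨ c that puts s into F also puts
-- t into F. By distributivity such contexts compose, so ⊑ᶠ is monotone in ∧ and ∨; carrying the
-- negations along and pushing ¬ inwards with the De Morgan laws, the relation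
--   Θ s t  :⇔  s ≈ᶠ t  and  ¬s ≈ᶠ ¬t
-- is a congruence compatible with F, hence contained in Ω F, while Ω F ⊆ ⊑ᶠ always.
-- The second rule says exactly that a ∈ F gives a ∨ ¬a ⊑ᶠ a; used once more under ∧ ¬a it also
-- gives ¬a ⊑ᶠ ¬(a ∨ ¬a), so ⟨a ∨ ¬a, a⟩ ∈ Θ ⊆ Ω F. The first rule puts a ∨ ¬a into F, so
-- ⟨a ∨ ¬a, a⟩ ∈ Ω F forces a ∈ F. Conversely, truth-equationality applied to the models
-- ⟨Fm, Δ ⊢_⟩, in which De Morgan-lattice identities are Leibniz equivalences, yields both rules.
module Submission where

open import Defs
open import Level using (0ℓ; Lift; lift; lower) renaming (suc to lsuc; zero to lzero)
open import Data.Nat using (ℕ; zero; suc)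
open import Function using (const; _∘_)
open import Relation.Binary.PropositionalEquality using (_≡_; refl; sym; trans; cong; cong₂; subst; subst₂)
open import Relation.Binary.Bundles using (Setoid)
open import Relation.Binary.Structures using (IsEquivalence)
import Relation.Binary.Reasoning.Setoid as SetoidReasoning
import Relation.Binary.Construct.On as On
open import Data.Product.Relation.Binary.Pointwise.NonDependent using (×-isEquivalence)
open import Data.Product using (_×_; _,_; proj₁; proj₂)
open import Data.Sum using (inj₁; inj₂)
open import Algebra.Lattice.Bundles using (DistributiveLattice)
import Algebra.Lattice.Properties.Lattice as LatticeProperties
open import Relation.Binary.Lattice.Bundles using () renaming (Lattice to OrderLattice)
import Relation.Binary.Lattice.Properties.JoinSemilattice as JoinSemilatticeProperties
import Relation.Binary.Lattice.Properties.MeetSemilattice as MeetSemilatticeProperties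

module DeMorganLatticeProperties (D : DeMorganLattice) where
  open DeMorganLattice D

  distributiveLattice : DistributiveLattice 0ℓ 0ℓ
  distributiveLattice = record { isDistributiveLattice = isDistributiveLattice }

  open DistributiveLattice distributiveLattice public
    using (∧-comm; ∧-assoc; ∨-comm; ∨-assoc; ∧-distribʳ-∨)

  orderLattice : OrderLattice 0ℓ 0ℓ 0ℓ
  orderLattice = record { isLattice = ∨-∧-isOrderTheoreticLattice }
    where open LatticeProperties (DistributiveLattice.lattice distributiveLattice)

  open OrderLattice orderLattice public
    using (x≤x∨y; y≤x∨y; x∧y≤x; x∧y≤y; ∨-least; ∧-greatest)
    renaming (_≤_ to _≼_; refl to ≼-refl; trans to ≼-trans; reflexive to ≼-reflexive)
  open JoinSemilatticeProperties (OrderLattice.joinSemilattice orderLattice) public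
    using (∨-monotonic; x≤y⇒x∨y≈y)
  open MeetSemilatticeProperties (OrderLattice.meetSemilattice orderLattice) public
    using (∧-monotonic)

  ≼⇒≤ : ∀ {a b} → a ≼ b → a ≤ b
  ≼⇒≤ = sym

  ≼-context : ∀ {a b} c d → a ≼ b → (a ⊓ c) ⊔ₐ d ≼ (b ⊓ c) ⊔ₐ d
  ≼-context c d a≼b = ∨-monotonic (∧-monotonic a≼b ≼-refl) ≼-refl

module DMP = DeMorganLatticeProperties

eval-substFm : ∀ A v σ φ → eval A v (substFm σ φ) ≡ eval A (λ n → eval A v (σ n)) φ
eval-substFm A v σ (var n) = refl
eval-substFm A v σ (φ ∧̂ ψ) = cong₂ (Algebra._⊓_ A) (eval-substFm A v σ φ) (eval-substFm A v σ ψ)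
eval-substFm A v σ (φ ∨̂ ψ) = cong₂ (Algebra._⊔ₐ_ A) (eval-substFm A v σ φ) (eval-substFm A v σ ψ)
eval-substFm A v σ (¬̂ φ)    = cong (Algebra.∼_ A) (eval-substFm A v σ φ)

w : Fm
w = var 3

inContext : Fm → Fm
inContext φ = (substFm (λ n → var (suc (suc n))) φ ∧̂ x) ∨̂ y

eval-inContext : ∀ A v φ → let open Algebra A in
  eval A v (inContext φ) ≡ (eval A (λ n → v (suc (suc n))) φ ⊓ v 0) ⊔ₐ v 1
eval-inContext A v φ =
  cong (λ a → Algebra._⊔ₐ_ A (Algebra._⊓_ A a (v 0)) (v 1)) (eval-substFm A v _ φ)

evalᴰ : (D : DeMorganLattice) → (ℕ → DeMorganLattice.Carrier D) → Fm → DeMorganLattice.Carrier D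
evalᴰ D = eval (DeMorganLattice.toAlgebra D)

infix 4 _≈ᴰᴹ_ _⊑ᴰᴹ_
record _≈ᴰᴹ_ (φ ψ : Fm) : Set₁ where
  field ≈-valid : ∀ D v → evalᴰ D v φ ≡ evalᴰ D v ψ

record _⊑ᴰᴹ_ (φ ψ : Fm) : Set₁ where
  field ⊑-valid : ∀ D v → DMP._≼_ D (evalᴰ D v φ) (evalᴰ D v ψ)

open _≈ᴰᴹ_
open _⊑ᴰᴹ_

≈ᴰᴹ⇒⊑ᴰᴹ : ∀ {φ ψ} → φ ≈ᴰᴹ ψ → φ ⊑ᴰᴹ ψ
≈ᴰᴹ⇒⊑ᴰᴹ φ≈ψ .⊑-valid D v = DMP.≼-reflexive D (φ≈ψ .≈-valid D v)

⊑ᴰᴹ-inContext : ∀ {φ ψ} → φ ⊑ᴰᴹ ψ → inContext φ ⊑ᴰᴹ inContext ψ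
⊑ᴰᴹ-inContext {φ} {ψ} φ⊑ψ .⊑-valid D v =
  subst₂ _≼_ (sym (eval-inContext A v φ)) (sym (eval-inContext A v ψ))
    (≼-context (v 0) (v 1) (φ⊑ψ .⊑-valid D (λ n → v (suc (suc n)))))
  where
  open DMP D
  A = DeMorganLattice.toAlgebra D

singleton : Fm → FmSet
singleton φ ψ = Lift (lsuc lzero) (ψ ≡ φ)

⊑ᴰᴹ⇒⊢BD : ∀ {φ ψ} → φ ⊑ᴰᴹ ψ → singleton φ ⊢BD ψ
⊑ᴰᴹ⇒⊢BD {φ} φ⊑ψ D F isUpset v holds =
  lift (isUpset (lower (holds φ (lift refl))) (DMP.≼⇒≤ D (φ⊑ψ .⊑-valid D v)))

≈ᴰᴹ-isEquivalence : IsEquivalence _≈ᴰᴹ_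
≈ᴰᴹ-isEquivalence = record
  { refl  = record { ≈-valid = λ D v → refl }
  ; sym   = λ φ≈ψ → record { ≈-valid = λ D v → sym (φ≈ψ .≈-valid D v) }
  ; trans = λ φ≈ψ ψ≈χ → record { ≈-valid = λ D v → trans (φ≈ψ .≈-valid D v) (ψ≈χ .≈-valid D v) }
  }

open IsEquivalence ≈ᴰᴹ-isEquivalence using () renaming (sym to ≈ᴰᴹ-sym)

∧̂-comm : x ∧̂ y ≈ᴰᴹ y ∧̂ x
∧̂-comm .≈-valid D v = DMP.∧-comm D (v 0) (v 1)

∨̂-comm : x ∨̂ y ≈ᴰᴹ y ∨̂ x
∨̂-comm .≈-valid D v = DMP.∨-comm D (v 0) (v 1)

¬̂¬̂-involutive : ¬̂ ¬̂ x ≈ᴰᴹ x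
¬̂¬̂-involutive .≈-valid D v = DeMorganLattice.∼-involutive D (v 0)

¬̂-distrib-∧̂ : ¬̂ (x ∧̂ y) ≈ᴰᴹ ¬̂ x ∨̂ ¬̂ y
¬̂-distrib-∧̂ .≈-valid D v = DeMorganLattice.∼-⊓ D (v 0) (v 1)

¬̂-distrib-∨̂ : ¬̂ (x ∨̂ y) ≈ᴰᴹ ¬̂ x ∧̂ ¬̂ y
¬̂-distrib-∨̂ .≈-valid D v = DeMorganLattice.∼-⊔ D (v 0) (v 1)

∧̂-assoc-under-∨̂ : ((x ∧̂ y) ∧̂ z) ∨̂ w ≈ᴰᴹ (x ∧̂ (y ∧̂ z)) ∨̂ w
∧̂-assoc-under-∨̂ .≈-valid D v = cong (_⊔ₐ v 3) (∧-assoc (v 0) (v 1) (v 2))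
  where open DeMorganLattice D; open DMP D

∧̂-distribʳ-∨̂-under-∨̂ : ((x ∨̂ y) ∧̂ z) ∨̂ w ≈ᴰᴹ (x ∧̂ z) ∨̂ ((y ∧̂ z) ∨̂ w)
∧̂-distribʳ-∨̂-under-∨̂ .≈-valid D v =
  trans (cong (_⊔ₐ v 3) (∧-distribʳ-∨ (v 2) (v 0) (v 1))) (∨-assoc _ _ _)
  where open DeMorganLattice D; open DMP D

x⊑x∨¬x : x ⊑ᴰᴹ x ∨̂ ¬̂ x
x⊑x∨¬x .⊑-valid D v = x≤x∨y _ _
  where open DMP D

¬[x∨¬x]⊑¬x : ¬̂ (x ∨̂ ¬̂ x) ⊑ᴰᴹ ¬̂ x
¬[x∨¬x]⊑¬x .⊑-valid D v = ≼-trans (≼-reflexive (∼-⊔ _ _)) (x∧y≤x _ _)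
  where open DeMorganLattice D; open DMP D

¬x⊑[x∨¬x]∧¬x : ¬̂ x ⊑ᴰᴹ (x ∨̂ ¬̂ x) ∧̂ ¬̂ x
¬x⊑[x∨¬x]∧¬x .⊑-valid D v = ∧-greatest (y≤x∨y _ _) ≼-refl
  where open DMP D

x∧¬x⊑¬[x∨¬x] : x ∧̂ ¬̂ x ⊑ᴰᴹ ¬̂ (x ∨̂ ¬̂ x)
x∧¬x⊑¬[x∨¬x] .⊑-valid D v =
  ≼-trans (∧-greatest (x∧y≤y _ _) (≼-trans (x∧y≤x _ _) (≼-reflexive (sym (∼-involutive _)))))
          (≼-reflexive (sym (∼-⊔ _ _)))
  where open DeMorganLattice D; open DMP D

[x∨¬x]∨¬[x∨¬x]≈x∨¬x : (x ∨̂ ¬̂ x) ∨̂ ¬̂ (x ∨̂ ¬̂ x) ≈ᴰᴹ x ∨̂ ¬̂ x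
[x∨¬x]∨¬[x∨¬x]≈x∨¬x .≈-valid D v =
  trans (∨-comm _ _) (x≤y⇒x∨y≈y (≼-trans (¬[x∨¬x]⊑¬x .⊑-valid D v) (y≤x∨y _ _)))
  where open DMP D

x⊑[x∧x]∨y : x ⊑ᴰᴹ (x ∧̂ x) ∨̂ y
x⊑[x∧x]∨y .⊑-valid D v = ≼-trans (∧-greatest ≼-refl ≼-refl) (x≤x∨y _ _)
  where open DMP D

[y∧x]∨y⊑y : (y ∧̂ x) ∨̂ y ⊑ᴰᴹ y
[y∧x]∨y⊑y .⊑-valid D v = ∨-least (x∧y≤x _ _) ≼-refl
  where open DMP D

module ContextOrder (A : Algebra) (F : Algebra.Carrier A → Set₁) where
  open Algebra A

  infix 4 _⊑ᶠ_
  _⊑ᶠ_ : Carrier → Carrier → Set₁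
  s ⊑ᶠ t = ∀ b c → F ((s ⊓ b) ⊔ₐ c) → F ((t ⊓ b) ⊔ₐ c)

  Leibniz⇒⊑ᶠ : ∀ {s t} → Leibniz A F s t → s ⊑ᶠ t
  Leibniz⇒⊑ᶠ (θ , θ-isCongruence , θ-compatible , sθt) b c h =
    θ-compatible h (⊔-cong (⊓-cong sθt θ-refl) θ-refl)
    where
    open IsCongruence θ-isCongruence
    open IsEquivalence isEquivalence using () renaming (refl to θ-refl)

FmA : Algebra
FmA = record { Carrier = Fm ; _⊓_ = _∧̂_ ; _⊔ₐ_ = _∨̂_ ; ∼_ = ¬̂_ }

eval-FmA : ∀ σ φ → eval FmA σ φ ≡ substFm σ φ
eval-FmA σ (var n) = refl
eval-FmA σ (φ ∧̂ ψ) = cong₂ _∧̂_ (eval-FmA σ φ) (eval-FmA σ ψ)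
eval-FmA σ (φ ∨̂ ψ) = cong₂ _∨̂_ (eval-FmA σ φ) (eval-FmA σ ψ)
eval-FmA σ (¬̂ φ)    = cong ¬̂_ (eval-FmA σ φ)

theory-isModel : ∀ L Δ → Model L FmA (Logic._⊢_ L Δ)
theory-isModel L Δ Γ φ Γ⊢φ σ Δ⊢σ[Γ] =
  subst (Δ ⊢_) (sym (eval-FmA σ φ))
    (cut (λ { _ (χ , χ∈Γ , lift refl) → subst (Δ ⊢_) (eval-FmA σ χ) (Δ⊢σ[Γ] χ χ∈Γ) })
         (structural σ Γ⊢φ))
  where open Logic L

≈ᴰᴹ-isCongruence : IsCongruence FmA _≈ᴰᴹ_
≈ᴰᴹ-isCongruence = record
  { isEquivalence = ≈ᴰᴹ-isEquivalence
  ; ⊓-cong = λ φ≈ψ χ≈ξ → record { ≈-valid = λ D v →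
      cong₂ (DeMorganLattice._⊓_ D) (φ≈ψ .≈-valid D v) (χ≈ξ .≈-valid D v) }
  ; ⊔-cong = λ φ≈ψ χ≈ξ → record { ≈-valid = λ D v →
      cong₂ (DeMorganLattice._⊔ₐ_ D) (φ≈ψ .≈-valid D v) (χ≈ξ .≈-valid D v) }
  ; ∼-cong = λ φ≈ψ → record { ≈-valid = λ D v → cong (DeMorganLattice.∼_ D) (φ≈ψ .≈-valid D v) }
  }

≈ᴰᴹ-compatible : ∀ L → ExtendsBD L → ∀ Δ → Compatible FmA (Logic._⊢_ L Δ) _≈ᴰᴹ_
≈ᴰᴹ-compatible L extendsBD Δ Δ⊢φ φ≈ψ =
  cut (λ { _ (lift refl) → Δ⊢φ }) (extendsBD _ _ (⊑ᴰᴹ⇒⊢BD (≈ᴰᴹ⇒⊑ᴰᴹ φ≈ψ)))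
  where open Logic L

truthEquational⇒validatesRules : ∀ L → ExtendsBD L → TruthEquational L → ValidatesRules L
truthEquational⇒validatesRules L extendsBD truthEquational = excludedMiddle , rule₂
  where
  open Logic L

  excludedMiddle : ∅ ⊢ (x ∨̂ ¬̂ x)
  excludedMiddle = proj₂ (truthEquational FmA (∅ ⊢_) (theory-isModel L ∅) (x ∨̂ ¬̂ x))
    (_≈ᴰᴹ_ , ≈ᴰᴹ-isCongruence , ≈ᴰᴹ-compatible L extendsBD ∅ , [x∨¬x]∨¬[x∨¬x]≈x∨¬x)

  rule₂ : premises₂ ⊢ ((x ∧̂ y) ∨̂ z)
  rule₂ = Leibniz⇒⊑ᶠ x∨¬x-Ω-x y z (reflexive (lift (inj₂ refl)))
    where
    open ContextOrder FmA (premises₂ ⊢_)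
    x∨¬x-Ω-x : Leibniz FmA (premises₂ ⊢_) (x ∨̂ ¬̂ x) x
    x∨¬x-Ω-x = proj₁ (truthEquational FmA (premises₂ ⊢_) (theory-isModel L premises₂) x)
      (reflexive (lift (inj₁ refl)))

infixr 5 _∷_
_∷_ : {C : Set} → C → (ℕ → C) → ℕ → C
(a ∷ v) zero    = a
(a ∷ v) (suc n) = v n

module ModelOfExtension (L : Logic) (extendsBD : ExtendsBD L)
                        (A : Algebra) (F : Algebra.Carrier A → Set₁) (model : Model L A F) where
  open Algebra A
  open ContextOrder A F

  transfer : ∀ {φ ψ} → φ ⊑ᴰᴹ ψ → ∀ v → F (eval A v φ) → F (eval A v ψ)
  transfer {φ} {ψ} φ⊑ψ v φ∈F =
    model (singleton φ) ψ (extendsBD _ _ (⊑ᴰᴹ⇒⊢BD φ⊑ψ)) v λ { _ (lift refl) → φ∈F }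

  transfer-≈ : ∀ {φ ψ} → φ ≈ᴰᴹ ψ → ∀ v → F (eval A v φ) → F (eval A v ψ)
  transfer-≈ = transfer ∘ ≈ᴰᴹ⇒⊑ᴰᴹ

  ⊑ᶠ-refl : ∀ {s} → s ⊑ᶠ s
  ⊑ᶠ-refl b c s∈F = s∈F

  ⊑ᶠ-trans : ∀ {s t u} → s ⊑ᶠ t → t ⊑ᶠ u → s ⊑ᶠ u
  ⊑ᶠ-trans s⊑t t⊑u b c = t⊑u b c ∘ s⊑t b c

  ⊑ᴰᴹ⇒⊑ᶠ : ∀ {φ ψ} → φ ⊑ᴰᴹ ψ → ∀ v → eval A v φ ⊑ᶠ eval A v ψ
  ⊑ᴰᴹ⇒⊑ᶠ {φ} {ψ} φ⊑ψ v b c =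
    subst F (eval-inContext A (b ∷ c ∷ v) ψ)
    ∘ transfer (⊑ᴰᴹ-inContext φ⊑ψ) (b ∷ c ∷ v)
    ∘ subst F (sym (eval-inContext A (b ∷ c ∷ v) φ))

  ∧-monoˡ-⊑ᶠ : ∀ {s t} u → s ⊑ᶠ t → s ⊓ u ⊑ᶠ t ⊓ u
  ∧-monoˡ-⊑ᶠ {s} {t} u s⊑t b c =
    transfer-≈ (≈ᴰᴹ-sym ∧̂-assoc-under-∨̂) (t ∷ u ∷ b ∷ const c)
    ∘ s⊑t (u ⊓ b) c
    ∘ transfer-≈ ∧̂-assoc-under-∨̂ (s ∷ u ∷ b ∷ const c)

  ∨-monoˡ-⊑ᶠ : ∀ {s t} u → s ⊑ᶠ t → s ⊔ₐ u ⊑ᶠ t ⊔ₐ u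
  ∨-monoˡ-⊑ᶠ {s} {t} u s⊑t b c =
    transfer-≈ (≈ᴰᴹ-sym ∧̂-distribʳ-∨̂-under-∨̂) (t ∷ u ∷ b ∷ const c)
    ∘ s⊑t b ((u ⊓ b) ⊔ₐ c)
    ∘ transfer-≈ ∧̂-distribʳ-∨̂-under-∨̂ (s ∷ u ∷ b ∷ const c)

  ∧-comm-⊑ᶠ : ∀ s t → s ⊓ t ⊑ᶠ t ⊓ s
  ∧-comm-⊑ᶠ s t = ⊑ᴰᴹ⇒⊑ᶠ (≈ᴰᴹ⇒⊑ᴰᴹ ∧̂-comm) (s ∷ const t)

  ∨-comm-⊑ᶠ : ∀ s t → s ⊔ₐ t ⊑ᶠ t ⊔ₐ s
  ∨-comm-⊑ᶠ s t = ⊑ᴰᴹ⇒⊑ᶠ (≈ᴰᴹ⇒⊑ᴰᴹ ∨̂-comm) (s ∷ const t)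

  ∧-mono-⊑ᶠ : ∀ {s t u w} → s ⊑ᶠ t → u ⊑ᶠ w → s ⊓ u ⊑ᶠ t ⊓ w
  ∧-mono-⊑ᶠ {s} {t} {u} {w} s⊑t u⊑w =
    ⊑ᶠ-trans (∧-monoˡ-⊑ᶠ u s⊑t) (⊑ᶠ-trans (∧-comm-⊑ᶠ t u)
      (⊑ᶠ-trans (∧-monoˡ-⊑ᶠ t u⊑w) (∧-comm-⊑ᶠ w t)))

  ∨-mono-⊑ᶠ : ∀ {s t u w} → s ⊑ᶠ t → u ⊑ᶠ w → s ⊔ₐ u ⊑ᶠ t ⊔ₐ w
  ∨-mono-⊑ᶠ {s} {t} {u} {w} s⊑t u⊑w =
    ⊑ᶠ-trans (∨-monoˡ-⊑ᶠ u s⊑t) (⊑ᶠ-trans (∨-comm-⊑ᶠ t u)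
      (⊑ᶠ-trans (∨-monoˡ-⊑ᶠ t u⊑w) (∨-comm-⊑ᶠ w t)))

  infix 4 _≈ᶠ_
  _≈ᶠ_ : Carrier → Carrier → Set₁
  s ≈ᶠ t = s ⊑ᶠ t × t ⊑ᶠ s

  ≈ᶠ-setoid : Setoid 0ℓ (lsuc 0ℓ)
  ≈ᶠ-setoid = record
    { Carrier = Carrier
    ; _≈_ = _≈ᶠ_
    ; isEquivalence = record
      { refl  = ⊑ᶠ-refl , ⊑ᶠ-refl
      ; sym   = λ (s⊑t , t⊑s) → t⊑s , s⊑t
      ; trans = λ (s⊑t , t⊑s) (t⊑u , u⊑t) → ⊑ᶠ-trans s⊑t t⊑u , ⊑ᶠ-trans u⊑t t⊑s
      }
    }

  ≈ᴰᴹ⇒≈ᶠ : ∀ {φ ψ} → φ ≈ᴰᴹ ψ → ∀ v → eval A v φ ≈ᶠ eval A v ψ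
  ≈ᴰᴹ⇒≈ᶠ φ≈ψ v = ⊑ᴰᴹ⇒⊑ᶠ (≈ᴰᴹ⇒⊑ᴰᴹ φ≈ψ) v , ⊑ᴰᴹ⇒⊑ᶠ (≈ᴰᴹ⇒⊑ᴰᴹ (≈ᴰᴹ-sym φ≈ψ)) v

  ∧-cong-≈ᶠ : ∀ {s t u w} → s ≈ᶠ t → u ≈ᶠ w → s ⊓ u ≈ᶠ t ⊓ w
  ∧-cong-≈ᶠ (s⊑t , t⊑s) (u⊑w , w⊑u) = ∧-mono-⊑ᶠ s⊑t u⊑w , ∧-mono-⊑ᶠ t⊑s w⊑u

  ∨-cong-≈ᶠ : ∀ {s t u w} → s ≈ᶠ t → u ≈ᶠ w → s ⊔ₐ u ≈ᶠ t ⊔ₐ w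
  ∨-cong-≈ᶠ (s⊑t , t⊑s) (u⊑w , w⊑u) = ∨-mono-⊑ᶠ s⊑t u⊑w , ∨-mono-⊑ᶠ t⊑s w⊑u

  Θ : Carrier → Carrier → Set₁
  Θ s t = s ≈ᶠ t × ∼ s ≈ᶠ ∼ t

  Θ-⊓-cong : ∀ {s t u w} → Θ s t → Θ u w → Θ (s ⊓ u) (t ⊓ w)
  Θ-⊓-cong {s} {t} {u} {w} (s≈t , ∼s≈∼t) (u≈w , ∼u≈∼w) = ∧-cong-≈ᶠ s≈t u≈w , (begin
    ∼ (s ⊓ u)       ≈⟨ ≈ᴰᴹ⇒≈ᶠ ¬̂-distrib-∧̂ (s ∷ const u) ⟩
    (∼ s) ⊔ₐ (∼ u)  ≈⟨ ∨-cong-≈ᶠ ∼s≈∼t ∼u≈∼w ⟩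
    (∼ t) ⊔ₐ (∼ w)  ≈⟨ ≈ᴰᴹ⇒≈ᶠ ¬̂-distrib-∧̂ (t ∷ const w) ⟨
    ∼ (t ⊓ w)       ∎)
    where open SetoidReasoning ≈ᶠ-setoid

  Θ-⊔-cong : ∀ {s t u w} → Θ s t → Θ u w → Θ (s ⊔ₐ u) (t ⊔ₐ w)
  Θ-⊔-cong {s} {t} {u} {w} (s≈t , ∼s≈∼t) (u≈w , ∼u≈∼w) = ∨-cong-≈ᶠ s≈t u≈w , (begin
    ∼ (s ⊔ₐ u)     ≈⟨ ≈ᴰᴹ⇒≈ᶠ ¬̂-distrib-∨̂ (s ∷ const u) ⟩
    (∼ s) ⊓ (∼ u)  ≈⟨ ∧-cong-≈ᶠ ∼s≈∼t ∼u≈∼w ⟩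
    (∼ t) ⊓ (∼ w)  ≈⟨ ≈ᴰᴹ⇒≈ᶠ ¬̂-distrib-∨̂ (t ∷ const w) ⟨
    ∼ (t ⊔ₐ w)     ∎)
    where open SetoidReasoning ≈ᶠ-setoid

  Θ-∼-cong : ∀ {s t} → Θ s t → Θ (∼ s) (∼ t)
  Θ-∼-cong {s} {t} (s≈t , ∼s≈∼t) = ∼s≈∼t , (begin
    ∼ (∼ s)  ≈⟨ ≈ᴰᴹ⇒≈ᶠ ¬̂¬̂-involutive (const s) ⟩
    s        ≈⟨ s≈t ⟩
    t        ≈⟨ ≈ᴰᴹ⇒≈ᶠ ¬̂¬̂-involutive (const t) ⟨
    ∼ (∼ t)  ∎)
    where open SetoidReasoning ≈ᶠ-setoid

  Θ-isCongruence : IsCongruence A Θ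
  Θ-isCongruence = record
    { isEquivalence = On.isEquivalence (λ a → a , ∼ a) (×-isEquivalence ≈ᶠ-isEquivalence ≈ᶠ-isEquivalence)
    ; ⊓-cong = Θ-⊓-cong
    ; ⊔-cong = Θ-⊔-cong
    ; ∼-cong = Θ-∼-cong
    }
    where open Setoid ≈ᶠ-setoid using () renaming (isEquivalence to ≈ᶠ-isEquivalence)

  Θ-compatible : Compatible A F Θ
  Θ-compatible {s} {t} s∈F ((s⊑t , _) , _) =
    transfer [y∧x]∨y⊑y (s ∷ const t) (s⊑t s t (transfer x⊑[x∧x]∨y (s ∷ const t) s∈F))

  module _ (rule₂ : Logic._⊢_ L premises₂ ((x ∧̂ y) ∨̂ z)) {a : Carrier} (a∈F : F a) where

    a∨¬a⊑ᶠa : a ⊔ₐ (∼ a) ⊑ᶠ a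
    a∨¬a⊑ᶠa b c [a∨¬a]∧b∨c∈F = model premises₂ _ rule₂ (a ∷ b ∷ const c)
      λ { _ (lift (inj₁ refl)) → a∈F ; _ (lift (inj₂ refl)) → [a∨¬a]∧b∨c∈F }

    ¬a⊑ᶠ¬[a∨¬a] : ∼ a ⊑ᶠ ∼ (a ⊔ₐ (∼ a))
    ¬a⊑ᶠ¬[a∨¬a] =
      ⊑ᶠ-trans (⊑ᴰᴹ⇒⊑ᶠ ¬x⊑[x∨¬x]∧¬x (const a))
        (⊑ᶠ-trans (∧-monoˡ-⊑ᶠ (∼ a) a∨¬a⊑ᶠa) (⊑ᴰᴹ⇒⊑ᶠ x∧¬x⊑¬[x∨¬x] (const a)))

    Θ-a∨¬a-a : Θ (a ⊔ₐ (∼ a)) a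
    Θ-a∨¬a-a =
      (a∨¬a⊑ᶠa , ⊑ᴰᴹ⇒⊑ᶠ x⊑x∨¬x (const a)) , (⊑ᴰᴹ⇒⊑ᶠ ¬[x∨¬x]⊑¬x (const a) , ¬a⊑ᶠ¬[a∨¬a])

validatesRules⇒truthEquational : ∀ L → ExtendsBD L → ValidatesRules L → TruthEquational L
validatesRules⇒truthEquational L extendsBD (excludedMiddle , rule₂) A F model a =
  (λ a∈F → Θ , Θ-isCongruence , Θ-compatible , Θ-a∨¬a-a rule₂ a∈F) ,
  (λ (θ , _ , θ-compatible , a∨¬a-θ-a) →
     θ-compatible (model ∅ _ excludedMiddle (const a) λ { _ (lift ()) }) a∨¬a-θ-a)
  where open ModelOfExtension L extendsBD A F model

mainTheorem17 : (L : Logic) → ExtendsBD L →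
    (TruthEquational L → ValidatesRules L) × (ValidatesRules L → TruthEquational L)
mainTheorem17 L extendsBD =
  truthEquational⇒validatesRules L extendsBD , validatesRules⇒truthEquational L extendsBD
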